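{- Let $f$ be a problem that is $1$-weakly discontinuous. Then $\mathsf{LPO}\le^*_W f$.
   Context: A problem is a partial multivalued function $f:\subseteq \mathbb{N}^\mathbb{N} \rightrightarrows \mathbb{N}^\mathbb{N}$; $\mathrm{dom}(f)$ is the set of $x$ with $f(x)\neq\emptyset$. Fix a standard computable pairing $\langle x,y\rangle$. $f\le^*_W g$ iff there are partial continuous $h,k:\subseteq\mathbb{N}^\mathbb{N}\to\mathbb{N}^\mathbb{N}$ such that for every $x\in\mathrm{dom}(f)$, $k(x)\in\mathrm{dom}(g)$ and for every $y\in g(k(x))$, $h(\langle x,y\rangle)\in f(x)$. For $x\in\mathbb{N}^\mathbb{N}$, $x|_n$ is its initial segment of length $n$. For positive $k$, $f$ is $k$-weakly continuous iff for every $x\in\mathrm{dom}(f)$ and every sequence $(y_n)_{n\in\mathbb{N}}\subseteq\mathrm{dom}(f)$ with $\lim_{n\to\infty}y_n=x$, there is $u\in f(x)$ such that for every $l<k$ and every $m\in\mathbb{N}$ there exist $n\ge m$ and $v\in f(y_{n\cdot k+l})$ with $u|_m=v|_m$; $k$-weakly discontinuous means not $k$-weakly continuous. $\mathsf{LPO}:\mathbb{N}^\mathbb{N}\to\mathbb{N}^\mathbb{N}$ maps $x$ to the constant-$0$ sequence if $x$ has a zero entry and to the constant-$1$ sequence otherwise. -}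

module Defs where

open import Data.Nat using (ℕ; zero; suc; _+_; _*_; _<_; _≤_)
open import Data.Product using (Σ; _×_)
open import Data.Sum using (_⊎_)
open import Relation.Nullary using (¬_)
open import Relation.Binary.PropositionalEquality using (_≡_)

Baire : Set
Baire = ℕ → ℕ

_≈[_]_ : Baire → ℕ → Baire → Set
x ≈[ n ] y = ∀ i → i < n → x i ≡ y i

tl : Baire → Baire
tl x n = x (suc n)

-- standard computable pairing: ⟨x,y⟩(2i) = x(i), ⟨x,y⟩(2i+1) = y(i)
⟨_,_⟩ : Baire → Baire → Baire
⟨ x , y ⟩ zero = x zero
⟨ x , y ⟩ (suc zero) = y zero
⟨ x , y ⟩ (suc (suc n)) = ⟨ tl x , tl y ⟩ n

-- a problem f :⊆ ℕ^ℕ ⇉ ℕ^ℕ, given by its graph:  f x y  means  y ∈ f(x)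
Problem : Set₁
Problem = Baire → Baire → Set

dom : Problem → Baire → Set
dom f x = Σ Baire (λ y → f x y)

record PartialContinuous : Set₁ where
  field
    D    : Baire → Set
    fun  : (x : Baire) → D x → Baire
    cont : ∀ x (dx : D x) (m : ℕ) →
           Σ ℕ (λ n → ∀ z (dz : D z) → x ≈[ n ] z → fun x dx ≈[ m ] fun z dz)
open PartialContinuous public

_≤*W_ : Problem → Problem → Set₁
f ≤*W g = Σ PartialContinuous (λ h → Σ PartialContinuous (λ k →
  ∀ x → dom f x →
    Σ (D k x) (λ dk →
      dom g (fun k x dk) ×
      (∀ y → g (fun k x dk) y →
         Σ (D h ⟨ x , y ⟩) (λ dh → f x (fun h ⟨ x , y ⟩ dh))))))

Converges : (ℕ → Baire) → Baire → Set
Converges ys x = ∀ m → Σ ℕ (λ N → ∀ n → N ≤ n → ys n ≈[ m ] x)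

-- k-weak continuity (meaningful for positive k)
WeaklyContinuous : ℕ → Problem → Set
WeaklyContinuous k f =
  ∀ x → dom f x → (ys : ℕ → Baire) → (∀ n → dom f (ys n)) → Converges ys x →
    Σ Baire (λ u → f x u ×
      (∀ l → l < k → ∀ m →
         Σ ℕ (λ n → m ≤ n × Σ Baire (λ v → f (ys (n * k + l)) v × u ≈[ m ] v))))

WeaklyDiscontinuous : ℕ → Problem → Set
WeaklyDiscontinuous k f = ¬ WeaklyContinuous k f

LPO : Problem
LPO x y = ((Σ ℕ (λ i → x i ≡ 0)) × (∀ n → y n ≡ 0))
        ⊎ ((∀ i → ¬ (x i ≡ 0)) × (∀ n → y n ≡ 1))

-- law of excluded middle (the classical ambient logic of the paper)
LEM : Set₁
LEM = (P : Set) → P ⊎ ¬ P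

{-# OPTIONS --safe #-}
module Submission where

-- Classically, 1-weak discontinuity yields a point x ∈ dom f and a sequence ys → x in dom f
-- such that every u ∈ f(x) eventually disagrees, on its first m digits, with every solution at
-- every ys n with n ≥ m. The reduction sends p to ys i, i the first zero of p, and to x if p has
-- no zero; this is continuous because ys → x. The backward map returns the LPO answer for p; it
-- is continuous on the pairs ⟨p, y⟩ with y a solution at the image of p: if p has no zero then
-- y ∈ f(x), and any nearby ⟨p′, y′⟩ whose p′ has a (necessarily late) first zero would give a
-- solution at some late ys i agreeing with y on a long prefix, which the separation forbids.

open import Defs
open import Axiom.DoubleNegationElimination using (DoubleNegationElimination; em⇒dne)
open import Data.Empty using (⊥-elim)
open import Data.Nat using (ℕ; zero; suc; _*_; _+_; _<_; _≤_; z≤n; s≤s; _≟_; _<?_)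
open import Data.Nat.Induction using (<-rec)
open import Data.Nat.Properties using (anyUpTo?; <-cmp; ≮⇒≥; n<1+n; m<n⇒m<1+n; +-identityʳ; *-identityʳ)
open import Data.Product using (Σ; ∃; _×_; _,_; proj₁; proj₂)
open import Data.Sum using (_⊎_; inj₁; inj₂)
open import Data.Unit using (⊤; tt)
open import Function using (const)
open import Level using (0ℓ)
open import Relation.Binary using (tri<; tri≈; tri>)
open import Relation.Binary.PropositionalEquality using (_≡_; _≢_; refl; sym; trans; cong; cong-app; subst)
open import Relation.Nullary using (¬_; yes; no)
open import Relation.Nullary.Decidable.Core using (fromSum)

dne : LEM → DoubleNegationElimination 0ℓ
dne lem = em⇒dne (fromSum (lem _))

¬∀⇒∃¬ : LEM → {A : Set} {P : A → Set} → ¬ (∀ a → P a) → ∃ λ a → ¬ P a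
¬∀⇒∃¬ lem ¬∀ = dne lem λ ¬∃ → ¬∀ λ a → dne lem λ ¬Pa → ¬∃ (a , ¬Pa)

¬∀∃¬⇒∃∀ : LEM → {A B : Set} {F : A → Set} {P : A → B → Set} →
          ¬ (∀ a → F a → ∃ λ b → ¬ P a b) → ∃ λ a → F a × ∀ b → P a b
¬∀∃¬⇒∃∀ lem ¬∀ = dne lem λ ¬∃ → ¬∀ λ a Fa → ¬∀⇒∃¬ lem λ ∀P → ¬∃ (a , Fa , ∀P)

≈-refl : ∀ {x n} → x ≈[ n ] x
≈-refl _ _ = refl

≈-sym : ∀ {x y n} → x ≈[ n ] y → y ≈[ n ] x
≈-sym x≈y i i<n = sym (x≈y i i<n)

≡⇒≈ : ∀ {x y n} → x ≡ y → x ≈[ n ] y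
≡⇒≈ x≡y i _ = cong-app x≡y i

≈-cons : ∀ {x y n} → x 0 ≡ y 0 → tl x ≈[ n ] tl y → x ≈[ suc n ] y
≈-cons x₀≡y₀ _   zero    _         = x₀≡y₀
≈-cons _     tl≈ (suc i) (s≤s i<n) = tl≈ i i<n

⟨,⟩-≈⁻ : ∀ n {x y x′ y′} → ⟨ x , y ⟩ ≈[ n * 2 ] ⟨ x′ , y′ ⟩ → x ≈[ n ] x′ × y ≈[ n ] y′
⟨,⟩-≈⁻ zero    _ = (λ _ ()) , (λ _ ())
⟨,⟩-≈⁻ (suc n) {x} {y} {x′} {y′} a =
  ≈-cons (a 0 (s≤s z≤n)) (proj₁ tails) , ≈-cons (a 1 (s≤s (s≤s z≤n))) (proj₂ tails)
  where
  tails : tl x ≈[ n ] tl x′ × tl y ≈[ n ] tl y′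
  tails = ⟨,⟩-≈⁻ n (λ i i<2n → a (suc (suc i)) (s≤s (s≤s i<2n)))

FirstZero : Baire → ℕ → Set
FirstZero p i = p i ≡ 0 × (∀ j → j < i → p j ≢ 0)

firstZero-unique : ∀ {p i j} → FirstZero p i → FirstZero p j → i ≡ j
firstZero-unique {i = i} {j} (pi≡0 , below-i) (pj≡0 , below-j) with <-cmp i j
... | tri< i<j _ _ = ⊥-elim (below-j i i<j pi≡0)
... | tri≈ _ i≡j _ = i≡j
... | tri> _ _ j<i = ⊥-elim (below-i j j<i pj≡0)

firstZero : ∀ {p} i → p i ≡ 0 → ∃ (FirstZero p)
firstZero {p} = <-rec _ search
  where
  search : ∀ i → (∀ {j} → j < i → p j ≡ 0 → ∃ (FirstZero p)) → p i ≡ 0 → ∃ (FirstZero p)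
  search i earlier pi≡0 with anyUpTo? (λ j → p j ≟ 0) i
  ... | yes (j , j<i , pj≡0) = earlier j<i pj≡0
  ... | no none              = i , pi≡0 , λ j j<i pj≡0 → none (j , j<i , pj≡0)

firstZero-≈ : ∀ {p p′ i} → FirstZero p i → p ≈[ suc i ] p′ → FirstZero p′ i
firstZero-≈ {i = i} (pi≡0 , below) p≈p′ =
  trans (sym (p≈p′ i (n<1+n i))) pi≡0 ,
  λ j j<i p′j≡0 → below j j<i (trans (p≈p′ j (m<n⇒m<1+n j<i)) p′j≡0)

noZero-≈⇒≤ : ∀ {p p′ n i} → (∀ j → p j ≢ 0) → p ≈[ n ] p′ → p′ i ≡ 0 → n ≤ i
noZero-≈⇒≤ {n = n} {i} noZero p≈p′ p′i≡0 with i <? n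
... | yes i<n = ⊥-elim (noZero i (trans (p≈p′ i i<n) p′i≡0))
... | no  i≮n = ≮⇒≥ i≮n

ZeroStatus : Baire → Set
ZeroStatus p = ∃ (FirstZero p) ⊎ (∀ i → p i ≢ 0)

zeroStatus : LEM → ∀ p → ZeroStatus p
zeroStatus lem p with lem (∃ λ i → p i ≡ 0)
... | inj₁ (i , pi≡0) = inj₁ (firstZero i pi≡0)
... | inj₂ none       = inj₂ λ i pi≡0 → none (i , pi≡0)

atFirstZero : ∀ {A : Set} {p} → (ℕ → A) → A → ZeroStatus p → A
atFirstZero a _ (inj₁ (i , _)) = a i
atFirstZero _ b (inj₂ _)       = b

atFirstZero-zero : ∀ {A : Set} {p i} {a : ℕ → A} {b} (s : ZeroStatus p) →
                   FirstZero p i → atFirstZero a b s ≡ a i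
atFirstZero-zero {a = a} (inj₁ (_ , fz)) fz′     = cong a (firstZero-unique fz fz′)
atFirstZero-zero         (inj₂ noZero)   (e , _) = ⊥-elim (noZero _ e)

atFirstZero-none : ∀ {A : Set} {p} {a : ℕ → A} {b} (s : ZeroStatus p) →
                   (∀ i → p i ≢ 0) → atFirstZero a b s ≡ b
atFirstZero-none (inj₁ (_ , e , _)) noZero = ⊥-elim (noZero _ e)
atFirstZero-none (inj₂ _)           _      = refl

atFirstZero-continuous : ∀ {ys x} → Converges ys x → ∀ {p} (s : ZeroStatus p) m →
  Σ ℕ λ N → ∀ {p′} (s′ : ZeroStatus p′) → p ≈[ N ] p′ →
    atFirstZero ys x s ≈[ m ] atFirstZero ys x s′
atFirstZero-continuous _ (inj₁ (i , fz)) m =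
  suc i , λ s′ p≈p′ → ≡⇒≈ (sym (atFirstZero-zero s′ (firstZero-≈ fz p≈p′)))
atFirstZero-continuous ys→x (inj₂ noZero) m = proj₁ (ys→x m) , λ where
  (inj₁ (i , e , _)) p≈p′ → ≈-sym (proj₂ (ys→x m) i (noZero-≈⇒≤ noZero p≈p′ e))
  (inj₂ _)           _    → ≈-refl

lpoAnswer : ∀ {p} → ZeroStatus p → Baire
lpoAnswer = atFirstZero (const (const 0)) (const 1)

lpoAnswer-solves : ∀ {p} (s : ZeroStatus p) → LPO p (lpoAnswer s)
lpoAnswer-solves (inj₁ (i , pi≡0 , _)) = inj₁ ((i , pi≡0) , λ _ → refl)
lpoAnswer-solves (inj₂ noZero)         = inj₂ (noZero , λ _ → refl)

Approximated : Problem → (ℕ → Baire) → Baire → ℕ → Set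
Approximated f ys u m = Σ ℕ λ n → m ≤ n × Σ Baire λ v → f (ys n) v × u ≈[ m ] v

record DiscontinuityWitness (f : Problem) : Set where
  field
    x         : Baire
    x∈dom     : dom f x
    ys        : ℕ → Baire
    ys∈dom    : ∀ n → dom f (ys n)
    ys→x      : Converges ys x
    separated : ∀ u → f x u → ∃ λ m → ¬ Approximated f ys u m

weaklyContinuous₁ : ∀ {f} →
  (∀ x → dom f x → ∀ ys → (∀ n → dom f (ys n)) → Converges ys x →
     ∃ λ u → f x u × ∀ m → Approximated f ys u m) →
  WeaklyContinuous 1 f
weaklyContinuous₁ {f} approximable x x∈dom ys ys∈dom ys→x
  with approximable x x∈dom ys ys∈dom ys→x
... | u , fxu , approx = u , fxu , λ { zero _ m → reindex (approx m) ; (suc _) (s≤s ()) }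
  where
  reindex : ∀ {m} → Approximated f ys u m → Approximated f (λ n → ys (n * 1 + 0)) u m
  reindex (n , m≤n , v , fv , u≈v) =
    n , m≤n , v , subst (λ k → f (ys k) v) (sym (trans (+-identityʳ (n * 1)) (*-identityʳ n))) fv , u≈v

weaklyDiscontinuous⇒witness : LEM → ∀ {f} → WeaklyDiscontinuous 1 f → DiscontinuityWitness f
weaklyDiscontinuous⇒witness lem ¬wc = dne lem λ ¬witness →
  ¬wc (weaklyContinuous₁ λ x x∈dom ys ys∈dom ys→x → ¬∀∃¬⇒∃∀ lem λ separated →
    ¬witness (record { x = x ; x∈dom = x∈dom ; ys = ys ; ys∈dom = ys∈dom
                     ; ys→x = ys→x ; separated = separated }))

module Reduction (lem : LEM) {f : Problem} (w : DiscontinuityWitness f) where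
  open DiscontinuityWitness w

  jump : Baire → Baire
  jump p = atFirstZero ys x (zeroStatus lem p)

  jump∈dom : ∀ p → dom f (jump p)
  jump∈dom p with zeroStatus lem p
  ... | inj₁ (i , _) = ys∈dom i
  ... | inj₂ _       = x∈dom

  K : PartialContinuous
  K = record
    { D    = const ⊤
    ; fun  = λ p _ → jump p
    ; cont = λ p _ m →
        let (N , close) = atFirstZero-continuous ys→x (zeroStatus lem p) m
        in N , λ p′ _ → close (zeroStatus lem p′)
    }

  lpoAnswer-locallyConstant : ∀ {p y} → f (jump p) y → (s : ZeroStatus p) →
    Σ ℕ λ N → ∀ {p′ y′} → f (jump p′) y′ → (s′ : ZeroStatus p′) →
      p ≈[ N ] p′ → y ≈[ N ] y′ → lpoAnswer s ≡ lpoAnswer s′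
  lpoAnswer-locallyConstant _ (inj₁ (i , fz)) =
    suc i , λ _ s′ p≈p′ _ → sym (atFirstZero-zero s′ (firstZero-≈ fz p≈p′))
  lpoAnswer-locallyConstant {p} {y} fy (inj₂ noZero) = M , constant
    where
    fxy : f x y
    fxy = subst (λ b → f b y) (atFirstZero-none (zeroStatus lem p) noZero) fy
    M : ℕ
    M = proj₁ (separated y fxy)
    constant : ∀ {p′ y′} → f (jump p′) y′ → (s′ : ZeroStatus p′) →
               p ≈[ M ] p′ → y ≈[ M ] y′ → lpoAnswer (inj₂ noZero) ≡ lpoAnswer s′
    constant {p′} {y′} fy′ (inj₁ (i , fz)) p≈p′ y≈y′ = ⊥-elim (proj₂ (separated y fxy)
      (i , noZero-≈⇒≤ noZero p≈p′ (proj₁ fz) , y′ ,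
       subst (λ b → f b y′) (atFirstZero-zero (zeroStatus lem p′) fz) fy′ , y≈y′))
    constant _ (inj₂ _) _ _ = refl

  Solution : Baire → Set
  Solution q = Σ Baire λ p → Σ Baire λ y → q ≡ ⟨ p , y ⟩ × f (jump p) y

  decode : ∀ q → Solution q → Baire
  decode _ (p , _) = lpoAnswer (zeroStatus lem p)

  decode-continuous : ∀ q (dq : Solution q) m → Σ ℕ λ N →
    ∀ q′ (dq′ : Solution q′) → q ≈[ N ] q′ → decode q dq ≈[ m ] decode q′ dq′
  decode-continuous _ (p , y , refl , fy) m =
    let (N , constant) = lpoAnswer-locallyConstant fy (zeroStatus lem p)
    in N * 2 , λ { _ (p′ , y′ , refl , fy′) q≈q′ →
         let (p≈p′ , y≈y′) = ⟨,⟩-≈⁻ N q≈q′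
         in ≡⇒≈ (constant fy′ (zeroStatus lem p′) p≈p′ y≈y′) }

  H : PartialContinuous
  H = record { D = Solution ; fun = decode ; cont = decode-continuous }

  LPO≤*W : LPO ≤*W f
  LPO≤*W = H , K , λ p _ →
    tt , jump∈dom p , λ y fy → (p , y , refl , fy) , lpoAnswer-solves (zeroStatus lem p)

lemma3p4 : LEM → (f : Problem) → WeaklyDiscontinuous 1 f → LPO ≤*W f
lemma3p4 lem f ¬wc = Reduction.LPO≤*W lem (weaklyDiscontinuous⇒witness lem ¬wc)
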